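{- Let $P=(X,\le)$ be a poset, $\mathcal{M}$ a collection of subsets of $X$ containing all singletons, $n$ a net in $P$ and $y\in X$. If $n$ $\mathcal{M}$-converges to $y$, then $\twoheaddownarrow_{\mathcal{M}} y\subseteq\operatorname{elb}(n)$. The converse holds if $P$ is $\mathcal{M}$-continuous.
   Context: $\mathcal{M}_\vee$ is the set of members of $\mathcal{M}$ with a supremum; $\mathcal{M}^\wedge=\{\downarrow M: M\in\mathcal{M}\}$. $x\ll_{\mathcal{M}} y$ iff for all $M\in\mathcal{M}_\vee$, $y\le\bigvee M$ implies $x\in\downarrow M$; $\twoheaddownarrow_{\mathcal{M}} y=\{x:x\ll_{\mathcal{M}} y\}$. $P$ is $\mathcal{M}$-continuous if for every $y$, $\twoheaddownarrow_{\mathcal{M}} y\in\mathcal{M}^\wedge$ and $y=\bigvee\twoheaddownarrow_{\mathcal{M}} y$. $\operatorname{elb}(n)$ is the set of eventual lower bounds of the net $n$; $n$ $\mathcal{M}$-converges to $y$ if there is $M\in\mathcal{M}_\vee$ with $M\subseteq\operatorname{elb}(n)$ and $y\le\bigvee M$. -}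

module Defs where

open import Level using (Level; _⊔_; suc)
open import Data.Product using (Σ; ∃; ∃-syntax; _×_; _,_)
open import Relation.Unary using (Pred; _∈_; _⊆_; _≐_)
open import Relation.Binary.Bundles using (Poset; Preorder)

record DirectedSet (d ℓd₁ ℓd₂ : Level) : Set (suc (d ⊔ ℓd₁ ⊔ ℓd₂)) where
  field
    preorder : Preorder d ℓd₁ ℓd₂
  open Preorder preorder public renaming (Carrier to D; _≲_ to _⊑_)
  field
    inhabited : D
    directed  : ∀ a b → ∃[ c ] (a ⊑ c × b ⊑ c)

module _ {c ℓ₁ ℓ₂ : Level} (P : Poset c ℓ₁ ℓ₂) where
  open Poset P renaming (Carrier to X)

  ｛_｝ : X → Pred X ℓ₁
  ｛ x ｝ = λ z → z ≈ x

  ↓ : ∀ {ℓ} → Pred X ℓ → Pred X (c ⊔ ℓ ⊔ ℓ₂)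
  ↓ A x = ∃[ a ] (a ∈ A × x ≤ a)

  IsSup : ∀ {ℓ} → Pred X ℓ → X → Set (c ⊔ ℓ ⊔ ℓ₂)
  IsSup A s = (∀ a → a ∈ A → a ≤ s) × (∀ u → (∀ a → a ∈ A → a ≤ u) → s ≤ u)

  -- A collection 𝓜 of subsets of X, presented as an indexed family
  -- 𝓜 = { S i : i ∈ I }.
  module _ {ι ℓ : Level} {I : Set ι} (S : I → Pred X ℓ) where

    ContainsSingletons : Set (c ⊔ ι ⊔ ℓ ⊔ ℓ₁)
    ContainsSingletons = ∀ x → ∃[ i ] (S i ≐ ｛ x ｝)

    _≪_ : X → X → Set (c ⊔ ι ⊔ ℓ ⊔ ℓ₂)
    x ≪ y = ∀ i → ∀ s → IsSup (S i) s → y ≤ s → x ∈ ↓ (S i)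

    ↡ : X → Pred X (c ⊔ ι ⊔ ℓ ⊔ ℓ₂)
    ↡ y = λ x → x ≪ y

    IsContinuous : Set (c ⊔ ι ⊔ ℓ ⊔ ℓ₂)
    IsContinuous = ∀ y → (∃[ i ] (↡ y ≐ ↓ (S i))) × IsSup (↡ y) y

    module _ {d ℓd₁ ℓd₂ : Level} (𝔻 : DirectedSet d ℓd₁ ℓd₂) where
      open DirectedSet 𝔻 using (D; _⊑_)

      elb : (D → X) → Pred X (d ⊔ ℓd₂ ⊔ ℓ₂)
      elb n x = ∃[ d₀ ] (∀ e → d₀ ⊑ e → x ≤ n e)

      MConverges : (D → X) → X → Set (c ⊔ ι ⊔ ℓ ⊔ ℓ₂ ⊔ d ⊔ ℓd₂)
      MConverges n y = ∃[ i ] ∃[ s ] (IsSup (S i) s × S i ⊆ elb n × y ≤ s)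

module Submission where

-- Both directions rest on two elementary facts about down-closure.
--  * elb(n) is a lower set, so any A ⊆ elb(n) has ↓A ⊆ elb(n).
--  * A set B that is cofinal in A (B ⊆ A ⊆ ↓B) has the same suprema as A.
-- Forward: if M ⊆ elb(n) has supremum s ≥ y, then by the definition of
-- ≪ every x ≪ y lies in ↓M, hence in elb(n).
-- Converse: continuity gives M with ↡y = ↓M and y = ⋁↡y.  Then M is
-- cofinal in ↡y, so ⋁M = y, and M ⊆ ↓M = ↡y ⊆ elb(n); thus M witnesses
-- convergence with y ≤ ⋁M by reflexivity.

open import Defs
open import Level using (Level; _⊔_)
open import Data.Product using (_×_; _,_)
open import Relation.Unary using (Pred; _⊆_)
open import Relation.Binary.Bundles using (Poset)

module _ {c ℓ₁ ℓ₂ : Level} (P : Poset c ℓ₁ ℓ₂) where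
  open Poset P renaming (Carrier to X)

  IsLowerSet : ∀ {ℓ} → Pred X ℓ → Set (c ⊔ ℓ₂ ⊔ ℓ)
  IsLowerSet L = ∀ {x z} → x ≤ z → L z → L x

  ⊆↓ : ∀ {ℓ} (A : Pred X ℓ) → A ⊆ ↓ P A
  ⊆↓ A {a} a∈A = a , a∈A , refl

  ↓-least : ∀ {ℓ ℓ'} {A : Pred X ℓ} {L : Pred X ℓ'}
          → IsLowerSet L → A ⊆ L → ↓ P A ⊆ L
  ↓-least lower A⊆L (a , a∈A , x≤a) = lower x≤a (A⊆L a∈A)

  IsSup-cofinal : ∀ {ℓ ℓ'} {A : Pred X ℓ} {B : Pred X ℓ'} {s : X}
                → B ⊆ A → A ⊆ ↓ P B → IsSup P A s → IsSup P B s
  IsSup-cofinal {A = A} {B} {s} B⊆A A⊆↓B (upper , least) = upperB , leastB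
    where
    upperB : ∀ b → B b → b ≤ s
    upperB b b∈B = upper b (B⊆A b∈B)

    -- An upper bound of B bounds A, since each a ∈ A lies below some b ∈ B.
    leastB : ∀ u → (∀ b → B b → b ≤ u) → s ≤ u
    leastB u boundB = least u λ a a∈A →
      let (b , b∈B , a≤b) = A⊆↓B a∈A in trans a≤b (boundB b b∈B)

  module _ {ι ℓ : Level} {I : Set ι} (S : I → Pred X ℓ) where

    ↡⊆↓ : ∀ {y} i s → IsSup P (S i) s → y ≤ s → ↡ P S y ⊆ ↓ P (S i)
    ↡⊆↓ i s sup y≤s x≪y = x≪y i s sup y≤s

    module _ {d ℓd₁ ℓd₂ : Level} (𝔻 : DirectedSet d ℓd₁ ℓd₂) where
      open DirectedSet 𝔻 using (D)

      elb-lower : (n : D → X) → IsLowerSet (elb P S 𝔻 n)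
      elb-lower n x≤z (d₀ , z≤n) = d₀ , λ e d₀⊑e → trans x≤z (z≤n e d₀⊑e)

      converges⇒↡⊆elb : ∀ n y → MConverges P S 𝔻 n y → ↡ P S y ⊆ elb P S 𝔻 n
      converges⇒↡⊆elb n y (i , s , sup , Sᵢ⊆elb , y≤s) x≪y =
        ↓-least (elb-lower n) Sᵢ⊆elb (↡⊆↓ i s sup y≤s x≪y)

      -- Converse under 𝓜-continuity: the member M with ↓M = ↡y witnesses
      -- convergence, its supremum being y itself.
      ↡⊆elb⇒converges : IsContinuous P S → ∀ n y
                      → ↡ P S y ⊆ elb P S 𝔻 n → MConverges P S 𝔻 n y
      ↡⊆elb⇒converges continuous n y ↡⊆elb
        with continuous y
      ... | (i , ↡⊆↓Sᵢ , ↓Sᵢ⊆↡) , y=⋁↡ =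
        i , y , supSᵢ , Sᵢ⊆elb , refl
        where
        Sᵢ⊆↡ : S i ⊆ ↡ P S y
        Sᵢ⊆↡ a∈Sᵢ = ↓Sᵢ⊆↡ (⊆↓ (S i) a∈Sᵢ)

        supSᵢ : IsSup P (S i) y
        supSᵢ = IsSup-cofinal Sᵢ⊆↡ ↡⊆↓Sᵢ y=⋁↡

        Sᵢ⊆elb : S i ⊆ elb P S 𝔻 n
        Sᵢ⊆elb a∈Sᵢ = ↡⊆elb (Sᵢ⊆↡ a∈Sᵢ)

lemma3p10 : ∀ {c ℓ₁ ℓ₂ ι ℓ d ℓd₁ ℓd₂ : Level}
    (P : Poset c ℓ₁ ℓ₂) {I : Set ι} (S : I → Pred (Poset.Carrier P) ℓ)
    → ContainsSingletons P S
    → (𝔻 : DirectedSet d ℓd₁ ℓd₂) (n : DirectedSet.D 𝔻 → Poset.Carrier P)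
    → (y : Poset.Carrier P)
    → (MConverges P S 𝔻 n y → ↡ P S y ⊆ elb P S 𝔻 n)
    × (IsContinuous P S → ↡ P S y ⊆ elb P S 𝔻 n → MConverges P S 𝔻 n y)
lemma3p10 P S _ 𝔻 n y =
    converges⇒↡⊆elb P S 𝔻 n y
  , λ continuous → ↡⊆elb⇒converges P S 𝔻 continuous n y
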